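{- Let $T$ be the group defined below. Then for each $i\in\{1,\ldots,k\}$ we have $A\cap A^{b_i}=C_i$ in $T$.
   Context: Let $L$ be a permutation group on a finite set $\Omega$ that is neither transitive nor semiregular. Let $\omega_1,\ldots,\omega_k$ ($k\ge 2$) be representatives of the $L$-orbits on $\Omega$, chosen so that $L_{\omega_1}\neq 1$, and let $n\ge 2$ be an integer. Let $b_1$ be the automorphism of $L_{\omega_1}^{n+1}$ given by $(x_0,x_1,\ldots,x_n)^{b_1}=(x_n,\ldots,x_1,x_0)$ and $b_2$ the automorphism of $L_{\omega_1}^n$ given by $(x_1,\ldots,x_n)^{b_2}=(x_n,\ldots,x_1)$; for $3\le i\le k$ let $\langle b_i\rangle$ be a cyclic group of order $2$. Define $A=L\times L_{\omega_1}^n$, $B_1=(L_{\omega_1}\times L_{\omega_1}^n)\rtimes\langle b_1\rangle$, $B_2=L_{\omega_2}\times(L_{\omega_1}^n\rtimes\langle b_2\rangle)$, $B_i=L_{\omega_i}\times L_{\omega_1}^n\times\langle b_i\rangle$ for $3\le i\le k$, and $C_i=L_{\omega_i}\times L_{\omega_1}^n$ for $1\le i\le k$, with $C_i$ embedded in the obvious way in both $A$ and $B_i$ (so $|B_i:C_i|=2$). Let $T=\langle A,B_1,\ldots,B_k\mid\mathcal R\rangle$, where $\mathcal R$ consists of the relations of $A,B_1,\ldots,B_k$ together with the identification of the two copies of $C_i$ in $A$ and $B_i$ for each $i$ (the fundamental group of the tree of groups with vertex groups $A,B_1,\ldots,B_k$ and edge groups $C_i$ joining $A$ to $B_i$). The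 groups $A,B_i,C_i$ embed in $T$ and are identified with their images; $A^{b_i}=b_i^{ -1}Ab_i$. -}

module Defs where

open import Level using (0ℓ)
open import Data.Nat using (ℕ; suc)
open import Data.Fin using (Fin; zero; suc; opposite)
open import Data.Fin.Permutation using (Permutation′; _⟨$⟩ʳ_; _⟨$⟩ˡ_; _∘ₚ_; flip; inverseˡ; inverseʳ)
import Data.Fin.Permutation as P
open import Data.Bool using (Bool; true; false; _xor_)
open import Data.Product using (Σ; ∃; ∃-syntax; _×_; _,_; proj₁; proj₂)
open import Data.Sum using (_⊎_; inj₁; inj₂)
open import Data.List using (List; []; _∷_; _++_; [_])
open import Data.Vec.Functional using (Vector; head; tail) renaming (_∷_ to _∷ᵥ_)
open import Relation.Nullary using (¬_)
open import Relation.Binary.PropositionalEquality using (_≡_; refl; cong; trans; sym)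
open import Algebra.Bundles.Raw using (RawGroup)

-- Permutation groups on Ω = Fin m.  Permutations act on the right:
-- ω ^ g = g ⟨$⟩ʳ ω, and (g ∘ₚ h) ⟨$⟩ʳ ω = h ⟨$⟩ʳ (g ⟨$⟩ʳ ω), i.e. g·h = g ∘ₚ h.

Perm : ℕ → Set
Perm m = Permutation′ m

record PermGroup (m : ℕ) : Set₁ where
  field
    InL   : Perm m → Set
    id∈   : InL P.id
    mul∈  : ∀ {g h} → InL g → InL h → InL (g ∘ₚ h)
    inv∈  : ∀ {g} → InL g → InL (flip g)
open PermGroup public

module _ {m : ℕ} (L : PermGroup m) where

  InOrbit : Fin m → Fin m → Set
  InOrbit α β = ∃[ g ] (InL L g × g ⟨$⟩ʳ α ≡ β)

  IsTransitive : Set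
  IsTransitive = ∀ α β → InOrbit α β

  IsSemiregular : Set
  IsSemiregular = ∀ α g → InL L g → g ⟨$⟩ʳ α ≡ α → g P.≈ P.id

  IsOrbitReps : {k : ℕ} → (Fin k → Fin m) → Set
  IsOrbitReps {k} ω = (∀ α → ∃[ i ] InOrbit (ω i) α)
                    × (∀ i j → InOrbit (ω i) (ω j) → i ≡ j)

  StabNontrivial : Fin m → Set
  StabNontrivial α = ∃[ g ] (InL L g × g ⟨$⟩ʳ α ≡ α × ¬ (g P.≈ P.id))

  Lel : Set
  Lel = Σ (Perm m) (InL L)

  Stab : Fin m → Set
  Stab α = Σ (Perm m) (λ g → InL L g × g ⟨$⟩ʳ α ≡ α)

  Lmul : Lel → Lel → Lel
  Lmul (g , p) (h , q) = g ∘ₚ h , mul∈ L p q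

  Linv : Lel → Lel
  Linv (g , p) = flip g , inv∈ L p

  Lone : Lel
  Lone = P.id , id∈ L

  _≈L_ : Lel → Lel → Set
  x ≈L y = proj₁ x P.≈ proj₁ y

  Smul : ∀ {α} → Stab α → Stab α → Stab α
  Smul {α} (g , p , e) (h , q , f) =
    g ∘ₚ h , mul∈ L p q , trans (cong (h ⟨$⟩ʳ_) e) f

  Sinv : ∀ {α} → Stab α → Stab α
  Sinv {α} (g , p , e) =
    flip g , inv∈ L p , trans (cong (g ⟨$⟩ˡ_) (sym e)) (inverseˡ g)

  Sone : ∀ {α} → Stab α
  Sone = P.id , id∈ L , refl

  _≈S_ : ∀ {α} → Stab α → Stab α → Set
  x ≈S y = proj₁ x P.≈ proj₁ y

  forget : ∀ {α} → Stab α → Lel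
  forget (g , p , _) = g , p

  module _ {α : Fin m} where
    Tup : ℕ → Set
    Tup r = Vector (Stab α) r

    Tmul : ∀ {r} → Tup r → Tup r → Tup r
    Tmul x y j = Smul (x j) (y j)

    Tinv : ∀ {r} → Tup r → Tup r
    Tinv x j = Sinv (x j)

    Tone : ∀ {r} → Tup r
    Tone _ = Sone

    _≈T_ : ∀ {r} → Tup r → Tup r → Set
    x ≈T y = ∀ j → x j ≈S y j

-- Fundamental group of a tree of groups: a central vertex group A joined
-- to vertex groups B i (i : Fin k) along edge groups C i, with embeddings
-- α i : C i → A and β i : C i → B i.  The group is given by the
-- presentation ⟨A, B_1, …, B_k | relations of A and the B_i, α i c = β i c⟩:
-- elements are words in the letters (elements of A and of the B_i) modulo
-- the congruence _∼_ generated by these relations.  (Since every letter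
-- has an inverse modulo _∼_, this monoid presentation is the group
-- presentation.)

module TreeOfGroups {k : ℕ}
    (A : RawGroup 0ℓ 0ℓ) (B C : Fin k → RawGroup 0ℓ 0ℓ)
    (α : ∀ i → RawGroup.Carrier (C i) → RawGroup.Carrier A)
    (β : ∀ i → RawGroup.Carrier (C i) → RawGroup.Carrier (B i)) where

  module A = RawGroup A
  module B (i : Fin k) = RawGroup (B i)

  Letter : Set
  Letter = A.Carrier ⊎ Σ (Fin k) (λ i → B.Carrier i)

  Word : Set
  Word = List Letter

  a⟨_⟩ : A.Carrier → Word
  a⟨ a ⟩ = [ inj₁ a ]

  b⟨_,_⟩ : (i : Fin k) → B.Carrier i → Word
  b⟨ i , b ⟩ = [ inj₂ (i , b) ]

  infix 4 _∼_
  data _∼_ : Word → Word → Set where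
    ∼-refl  : ∀ {u} → u ∼ u
    ∼-sym   : ∀ {u v} → u ∼ v → v ∼ u
    ∼-trans : ∀ {u v w} → u ∼ v → v ∼ w → u ∼ w
    ∼-++    : ∀ {u u′ v v′} → u ∼ u′ → v ∼ v′ → u ++ v ∼ u′ ++ v′
    A-≈     : ∀ {a a′} → a A.≈ a′ → a⟨ a ⟩ ∼ a⟨ a′ ⟩
    A-∙     : ∀ a a′ → a⟨ a ⟩ ++ a⟨ a′ ⟩ ∼ a⟨ a A.∙ a′ ⟩
    A-ε     : a⟨ A.ε ⟩ ∼ []
    B-≈     : ∀ i {b b′} → B._≈_ i b b′ → b⟨ i , b ⟩ ∼ b⟨ i , b′ ⟩
    B-∙     : ∀ i b b′ → b⟨ i , b ⟩ ++ b⟨ i , b′ ⟩ ∼ b⟨ i , B._∙_ i b b′ ⟩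
    B-ε     : ∀ i → b⟨ i , B.ε i ⟩ ∼ []
    amalg   : ∀ i c → a⟨ α i c ⟩ ∼ b⟨ i , β i c ⟩

  InA : Word → Set
  InA w = ∃[ a ] (w ∼ a⟨ a ⟩)

  InC : Fin k → Word → Set
  InC i w = ∃[ c ] (w ∼ a⟨ α i c ⟩)

  InA^ : (i : Fin k) → B.Carrier i → Word → Set
  InA^ i b w = ∃[ a ] (w ∼ b⟨ i , B._⁻¹ i b ⟩ ++ a⟨ a ⟩ ++ b⟨ i , b ⟩)

-- The concrete groups A, B_i, C_i of the construction.
-- Ω = Fin m, k = 2 + k′ orbit representatives ω; ω zero is ω₁ and
-- ω (suc zero) is ω₂.

module Construction {m : ℕ} (L : PermGroup m) (n : ℕ) {k′ : ℕ}
    (ω : Fin (suc (suc k′)) → Fin m) where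

  k : ℕ
  k = suc (suc k′)

  ω₁ : Fin m
  ω₁ = ω zero

  Pow : ℕ → Set
  Pow r = Tup L {ω₁} r

  Agrp : RawGroup 0ℓ 0ℓ
  Agrp = record
    { Carrier = Lel L × Pow n
    ; _≈_ = λ x y → _≈L_ L (proj₁ x) (proj₁ y) × _≈T_ L (proj₂ x) (proj₂ y)
    ; _∙_ = λ x y → Lmul L (proj₁ x) (proj₁ y) , Tmul L (proj₂ x) (proj₂ y)
    ; ε = Lone L , Tone L
    ; _⁻¹ = λ x → Linv L (proj₁ x) , Tinv L (proj₂ x)
    }

  Ccar : Fin k → Set
  Ccar i = Stab L (ω i) × Pow n

  Cmul : ∀ i → Ccar i → Ccar i → Ccar i
  Cmul i x y = Smul L (proj₁ x) (proj₁ y) , Tmul L (proj₂ x) (proj₂ y)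

  Cinv : ∀ i → Ccar i → Ccar i
  Cinv i x = Sinv L (proj₁ x) , Tinv L (proj₂ x)

  Cone : ∀ i → Ccar i
  Cone i = Sone L , Tone L

  _≈C_ : ∀ {i} → Ccar i → Ccar i → Set
  x ≈C y = _≈S_ L (proj₁ x) (proj₁ y) × _≈T_ L (proj₂ x) (proj₂ y)

  Cgrp : Fin k → RawGroup 0ℓ 0ℓ
  Cgrp i = record
    { Carrier = Ccar i ; _≈_ = _≈C_ ; _∙_ = Cmul i ; ε = Cone i ; _⁻¹ = Cinv i }

  rev : ∀ {r} → Pow r → Pow r
  rev x j = x (opposite j)

  -- the automorphism b_i of C_i (written on the right: c ↦ c^{b_i}):
  --   b₁ : (x₀,x₁,…,x_n) ↦ (x_n,…,x₁,x₀)   on L_{ω₁} × L_{ω₁}^n = L_{ω₁}^{n+1}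
  --   b₂ : (y, x₁,…,x_n) ↦ (y, x_n,…,x₁)   (acting on the L_{ω₁}^n factor)
  --   b_i (i ≥ 3) : trivial action (direct product)
  twist : ∀ i → Ccar i → Ccar i
  twist zero (x₀ , xs) = head v , tail v
    where
    v : Pow (suc n)
    v = rev (x₀ ∷ᵥ xs)
  twist (suc zero) (y , xs) = y , rev xs
  twist (suc (suc j)) c = c

  twist^ : ∀ i → Bool → Ccar i → Ccar i
  twist^ i false c = c
  twist^ i true c = twist i c

  -- B_i = C_i ⋊ ⟨b_i⟩; the pair (c , e) stands for c · b_i^e.
  -- (c b^e)(d b^f) = (c · d^{b^e}) b^{e+f},  (c b^e)⁻¹ = (c⁻¹)^{b^e} b^e.
  Bgrp : Fin k → RawGroup 0ℓ 0ℓ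
  Bgrp i = record
    { Carrier = Ccar i × Bool
    ; _≈_ = λ x y → proj₁ x ≈C proj₁ y × proj₂ x ≡ proj₂ y
    ; _∙_ = λ x y → Cmul i (proj₁ x) (twist^ i (proj₂ x) (proj₁ y))
                  , (proj₂ x xor proj₂ y)
    ; ε = Cone i , false
    ; _⁻¹ = λ x → twist^ i (proj₂ x) (Cinv i (proj₁ x)) , proj₂ x
    }

  b : ∀ i → RawGroup.Carrier (Bgrp i)
  b i = Cone i , true

  αC : ∀ i → Ccar i → RawGroup.Carrier Agrp
  αC i (x , xs) = forget L x , xs

  βC : ∀ i → Ccar i → RawGroup.Carrier (Bgrp i)
  βC i c = c , false

  open TreeOfGroups Agrp Bgrp Cgrp αC βC public

module Submission where

-- The inclusion C_i ⊆ A ∩ A^{b_i} is a computation inside B_i: conjugating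
-- the copy of c^{b_i} ∈ C_i ⊆ A by b_i gives back c, because b_i is an
-- involutive automorphism of C_i.
--
-- For the reverse inclusion we let T act on the set of points
-- Fin (n+1) × Maybe Ω: n+1 copies ("blocks") of Ω, each with one extra
-- point `nothing`.  A acts on block j by its j-th coordinate and fixes the
-- extra points; b_e permutes the blocks by an involution and swaps, in each
-- block, the extra point with the point fixed by the corresponding
-- coordinate of C_e.  Since every relation of the presentation of T holds
-- in this action (a general fact for actions of trees of groups, proved
-- first), the action is well defined on T.  The point x₀ = (0 , ω_i) is
-- fixed by every element of A^{b_i} (b_i moves it to an extra point, which
-- A fixes), while a ∈ A fixes x₀ only if its L-coordinate fixes ω_i, that
-- is, only if a ∈ C_i.

open import Defs
open import Data.Nat using (ℕ; suc; _≤_)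
open import Data.Fin using (Fin; zero; suc)
open import Data.Product using (_×_)
open import Relation.Nullary using (¬_)
open import Function.Bundles using (_⇔_)

open import Level using (0ℓ)
open import Algebra.Bundles.Raw using (RawGroup)
open import Data.Fin using (opposite; _≟_)
open import Data.Fin.Properties using (opposite-involutive)
open import Data.Fin.Permutation using (_⟨$⟩ʳ_)
open import Data.Bool using (Bool; true; false; _xor_)
open import Data.Product using (_,_; proj₁; proj₂)
open import Data.Sum using (inj₁; inj₂)
open import Data.List using ([]; _∷_; _++_)
open import Data.Maybe using (Maybe; just; nothing; map)
open import Data.Maybe.Properties using (just-injective; map-cong; map-∘; map-id)
open import Data.Vec.Functional using () renaming (_∷_ to _∷ᵥ_)
open import Function.Bundles using (Injection; mk⇔)
open import Function.Definitions using (Injective)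
open import Function.Properties.Inverse using (↔⇒↣)
open import Relation.Binary.Definitions using (DecidableEquality)
open import Relation.Nullary using (yes; no; contradiction)
open import Relation.Binary.PropositionalEquality
  using (_≡_; refl; cong; trans; sym; subst; module ≡-Reasoning)

open ≡-Reasoning

module TreeAction {k : ℕ}
    (A : RawGroup 0ℓ 0ℓ) (B C : Fin k → RawGroup 0ℓ 0ℓ)
    (α : ∀ i → RawGroup.Carrier (C i) → RawGroup.Carrier A)
    (β : ∀ i → RawGroup.Carrier (C i) → RawGroup.Carrier (B i)) where

  open TreeOfGroups A B C α β

  record Action (X : Set) : Set where
    field
      actA   : A.Carrier → X → X
      actA-≈ : ∀ {a a′} → a A.≈ a′ → ∀ x → actA a x ≡ actA a′ x
      actA-∙ : ∀ a a′ x → actA (a A.∙ a′) x ≡ actA a′ (actA a x)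
      actA-ε : ∀ x → actA A.ε x ≡ x
      actB   : ∀ i → B.Carrier i → X → X
      actB-≈ : ∀ i {b b′} → B._≈_ i b b′ → ∀ x → actB i b x ≡ actB i b′ x
      actB-∙ : ∀ i b b′ x → actB i (B._∙_ i b b′) x ≡ actB i b′ (actB i b x)
      actB-ε : ∀ i x → actB i (B.ε i) x ≡ x
      actC   : ∀ i c x → actA (α i c) x ≡ actB i (β i c) x

    actLetter : Letter → X → X
    actLetter (inj₁ a)       = actA a
    actLetter (inj₂ (i , b)) = actB i b

    actWord : Word → X → X
    actWord []      x = x
    actWord (l ∷ w) x = actWord w (actLetter l x)

    actWord-++ : ∀ u v x → actWord (u ++ v) x ≡ actWord v (actWord u x)
    actWord-++ []      v x = refl
    actWord-++ (l ∷ u) v x = actWord-++ u v (actLetter l x)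

    actWord-resp-∼ : ∀ {u v} → u ∼ v → ∀ x → actWord u x ≡ actWord v x
    actWord-resp-∼ ∼-refl        x = refl
    actWord-resp-∼ (∼-sym p)     x = sym (actWord-resp-∼ p x)
    actWord-resp-∼ (∼-trans p q) x = trans (actWord-resp-∼ p x) (actWord-resp-∼ q x)
    actWord-resp-∼ (∼-++ {u} {u′} {v} {v′} p q) x = begin
      actWord (u ++ v) x       ≡⟨ actWord-++ u v x ⟩
      actWord v (actWord u x)  ≡⟨ cong (actWord v) (actWord-resp-∼ p x) ⟩
      actWord v (actWord u′ x) ≡⟨ actWord-resp-∼ q (actWord u′ x) ⟩
      actWord v′ (actWord u′ x) ≡⟨ actWord-++ u′ v′ x ⟨
      actWord (u′ ++ v′) x     ∎
    actWord-resp-∼ (A-≈ p)       x = actA-≈ p x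
    actWord-resp-∼ (A-∙ a a′)    x = sym (actA-∙ a a′ x)
    actWord-resp-∼ A-ε           x = actA-ε x
    actWord-resp-∼ (B-≈ i p)     x = actB-≈ i p x
    actWord-resp-∼ (B-∙ i b b′)  x = sym (actB-∙ i b b′ x)
    actWord-resp-∼ (B-ε i)       x = actB-ε i x
    actWord-resp-∼ (amalg i c)   x = actC i c x

module _ {a} {S : Set a} (_≟ˢ_ : DecidableEquality S) where

  swapWith : S → Maybe S → Maybe S
  swapWith q nothing = just q
  swapWith q (just x) with x ≟ˢ q
  ... | yes _ = nothing
  ... | no _  = just x

  swapWith-self : ∀ q → swapWith q (just q) ≡ nothing
  swapWith-self q with q ≟ˢ q
  ... | yes _  = refl
  ... | no q≢q = contradiction refl q≢q

  swapWith-other : ∀ {q x} → ¬ x ≡ q → swapWith q (just x) ≡ just x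
  swapWith-other {q} {x} x≢q with x ≟ˢ q
  ... | yes x≡q = contradiction x≡q x≢q
  ... | no _    = refl

  swapWith-involutive : ∀ q mx → swapWith q (swapWith q mx) ≡ mx
  swapWith-involutive q nothing = swapWith-self q
  swapWith-involutive q (just x) with x ≟ˢ q
  ... | yes refl = refl
  ... | no x≢q   = swapWith-other x≢q

  swapWith-natural : ∀ {f : S → S} {q} → Injective _≡_ _≡_ f → f q ≡ q →
                     ∀ mx → map f (swapWith q mx) ≡ swapWith q (map f mx)
  swapWith-natural f-inj fq≡q nothing = cong just fq≡q
  swapWith-natural {f} {q} f-inj fq≡q (just x) with x ≟ˢ q
  ... | yes refl = sym (trans (cong (λ y → swapWith x (just y)) fq≡q) (swapWith-self x))
  ... | no x≢q   = sym (swapWith-other (λ fx≡q → x≢q (f-inj (trans fx≡q (sym fq≡q)))))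

module PointAction {m : ℕ} (L : PermGroup m) (n : ℕ) {k′ : ℕ}
    (ω : Fin (suc (suc k′)) → Fin m) where

  open Construction L n ω
  open TreeAction Agrp Bgrp Cgrp αC βC

  Point : Set
  Point = Fin (suc n) × Maybe (Fin m)

  component : A.Carrier → Fin (suc n) → Perm m
  component (g , xs) zero    = proj₁ g
  component (g , xs) (suc j) = proj₁ (xs j)

  SameCoordinates : A.Carrier → A.Carrier → Set
  SameCoordinates a a′ = ∀ j y → component a j ⟨$⟩ʳ y ≡ component a′ j ⟨$⟩ʳ y

  ActsTrivially : A.Carrier → Set
  ActsTrivially a = ∀ j y → component a j ⟨$⟩ʳ y ≡ y

  ≈⇒SameCoordinates : ∀ {a a′} → a A.≈ a′ → SameCoordinates a a′
  ≈⇒SameCoordinates (g≈g′ , xs≈xs′) zero    y = g≈g′ y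
  ≈⇒SameCoordinates (g≈g′ , xs≈xs′) (suc j) y = xs≈xs′ j y

  SameCoordinates⇒≈ : ∀ {a a′} → SameCoordinates a a′ → a A.≈ a′
  SameCoordinates⇒≈ same = same zero , λ j → same (suc j)

  component-∙ : ∀ a a′ j y →
    component (a A.∙ a′) j ⟨$⟩ʳ y ≡ component a′ j ⟨$⟩ʳ (component a j ⟨$⟩ʳ y)
  component-∙ a a′ zero    y = refl
  component-∙ a a′ (suc j) y = refl

  ε-trivial : ActsTrivially A.ε
  ε-trivial zero    y = refl
  ε-trivial (suc j) y = refl

  ε⁻¹-trivial : ∀ e → ActsTrivially (αC e (Cinv e (Cone e)))
  ε⁻¹-trivial e zero    y = refl
  ε⁻¹-trivial e (suc j) y = refl

  trivial-∙ˡ : ∀ {a a′} → ActsTrivially a → SameCoordinates (a A.∙ a′) a′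
  trivial-∙ˡ {a} {a′} triv j y =
    trans (component-∙ a a′ j y) (cong (component a′ j ⟨$⟩ʳ_) (triv j y))

  trivial-∙ʳ : ∀ {a a′} → ActsTrivially a′ → SameCoordinates (a A.∙ a′) a
  trivial-∙ʳ {a} {a′} triv j y = trans (component-∙ a a′ j y) (triv j _)

  actA : A.Carrier → Point → Point
  actA a (j , my) = j , map (component a j ⟨$⟩ʳ_) my

  actA-cong : ∀ {a a′} → SameCoordinates a a′ → ∀ x → actA a x ≡ actA a′ x
  actA-cong same (j , my) = cong (j ,_) (map-cong (same j) my)

  actA-trivial : ∀ {a} → ActsTrivially a → ∀ x → actA a x ≡ x
  actA-trivial triv (j , my) = cong (j ,_) (trans (map-cong (triv j) my) (map-id my))

  actA-∙ : ∀ a a′ x → actA (a A.∙ a′) x ≡ actA a′ (actA a x)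
  actA-∙ a a′ (j , my) = cong (j ,_) (trans (map-cong (component-∙ a a′ j) my) (map-∘ my))

  blockPerm : Fin k → Fin (suc n) → Fin (suc n)
  blockPerm zero          j       = opposite j
  blockPerm (suc zero)    zero    = zero
  blockPerm (suc zero)    (suc j) = suc (opposite j)
  blockPerm (suc (suc _)) j       = j

  blockPerm-involutive : ∀ e j → blockPerm e (blockPerm e j) ≡ j
  blockPerm-involutive zero          j       = opposite-involutive j
  blockPerm-involutive (suc zero)    zero    = refl
  blockPerm-involutive (suc zero)    (suc j) = cong suc (opposite-involutive j)
  blockPerm-involutive (suc (suc _)) j       = refl

  basePoint : Fin k → Fin (suc n) → Fin m
  basePoint e zero    = ω e
  basePoint e (suc j) = ω₁

  basePoint-fixed : ∀ e (c : Ccar e) j →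
    component (αC e c) j ⟨$⟩ʳ basePoint e j ≡ basePoint e j
  basePoint-fixed e (x , xs) zero    = proj₂ (proj₂ x)
  basePoint-fixed e (x , xs) (suc j) = proj₂ (proj₂ (xs j))

  basePoint-blockPerm : ∀ e j → basePoint e (blockPerm e j) ≡ basePoint e j
  basePoint-blockPerm zero j = trans (basePoint₁ (opposite j)) (sym (basePoint₁ j))
    where
    basePoint₁ : ∀ j → basePoint zero j ≡ ω₁
    basePoint₁ zero    = refl
    basePoint₁ (suc j) = refl
  basePoint-blockPerm (suc zero)    zero    = refl
  basePoint-blockPerm (suc zero)    (suc j) = refl
  basePoint-blockPerm (suc (suc _)) j       = refl

  component-cons : ∀ (c : Ccar zero) j →
    component (αC zero c) j ≡ proj₁ ((proj₁ c ∷ᵥ proj₂ c) j)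
  component-cons c zero    = refl
  component-cons c (suc j) = refl

  twist-component : ∀ e (c : Ccar e) j →
    component (αC e (twist e c)) j ≡ component (αC e c) (blockPerm e j)
  twist-component zero          c zero    = sym (component-cons c (opposite zero))
  twist-component zero          c (suc j) = sym (component-cons c (opposite (suc j)))
  twist-component (suc zero)    c zero    = refl
  twist-component (suc zero)    c (suc j) = refl
  twist-component (suc (suc _)) c j       = refl

  twist-involutive : ∀ e (c : Ccar e) → SameCoordinates (αC e (twist e (twist e c))) (αC e c)
  twist-involutive e c j y = begin
    component (αC e (twist e (twist e c))) j ⟨$⟩ʳ y
      ≡⟨ cong (_⟨$⟩ʳ y) (twist-component e (twist e c) j) ⟩
    component (αC e (twist e c)) (blockPerm e j) ⟨$⟩ʳ y
      ≡⟨ cong (_⟨$⟩ʳ y) (twist-component e c (blockPerm e j)) ⟩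
    component (αC e c) (blockPerm e (blockPerm e j)) ⟨$⟩ʳ y
      ≡⟨ cong (λ j′ → component (αC e c) j′ ⟨$⟩ʳ y) (blockPerm-involutive e j) ⟩
    component (αC e c) j ⟨$⟩ʳ y ∎

  twist-trivial : ∀ e (c : Ccar e) → ActsTrivially (αC e c) → ActsTrivially (αC e (twist e c))
  twist-trivial e c triv j y =
    trans (cong (_⟨$⟩ʳ y) (twist-component e c j)) (triv (blockPerm e j) y)

  bAct : Fin k → Point → Point
  bAct e (j , my) = blockPerm e j , swapWith _≟_ (basePoint e j) my

  bAct-involutive : ∀ e x → bAct e (bAct e x) ≡ x
  bAct-involutive e (j , my)
    rewrite basePoint-blockPerm e j | blockPerm-involutive e j =
    cong (j ,_) (swapWith-involutive _≟_ (basePoint e j) my)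

  -- the defining relation of B_e = C_e ⋊ ⟨b_e⟩:  b_e c = c^{b_e} b_e
  bAct-twist : ∀ e (c : Ccar e) x →
    actA (αC e c) (bAct e x) ≡ bAct e (actA (αC e (twist e c)) x)
  bAct-twist e c (j , my) = cong (blockPerm e j ,_) (begin
    map (g ⟨$⟩ʳ_) (swapWith _≟_ (basePoint e j) my)
      ≡⟨ swapWith-natural _≟_ (Injection.injective (↔⇒↣ g)) g-fixes my ⟩
    swapWith _≟_ (basePoint e j) (map (g ⟨$⟩ʳ_) my)
      ≡⟨ cong (λ h → swapWith _≟_ (basePoint e j) (map (h ⟨$⟩ʳ_) my)) (twist-component e c j) ⟨
    swapWith _≟_ (basePoint e j) (map (component (αC e (twist e c)) j ⟨$⟩ʳ_) my) ∎)
    where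
    g : Perm m
    g = component (αC e c) (blockPerm e j)
    g-fixes : g ⟨$⟩ʳ basePoint e j ≡ basePoint e j
    g-fixes = subst (λ q → g ⟨$⟩ʳ q ≡ q) (basePoint-blockPerm e j)
                    (basePoint-fixed e c (blockPerm e j))

  bPower : Fin k → Bool → Point → Point
  bPower e false x = x
  bPower e true  x = bAct e x

  bPower-xor : ∀ e f g x → bPower e g (bPower e f x) ≡ bPower e (f xor g) x
  bPower-xor e false g     x = refl
  bPower-xor e true  false x = refl
  bPower-xor e true  true  x = bAct-involutive e x

  bPower-twist : ∀ e f (c : Ccar e) x →
    actA (αC e c) (bPower e f x) ≡ bPower e f (actA (αC e (twist^ e f c)) x)
  bPower-twist e false c x = refl
  bPower-twist e true  c x = bAct-twist e c x

  actB : ∀ e → B.Carrier e → Point → Point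
  actB e (c , f) x = bPower e f (actA (αC e c) x)

  actB-∙ : ∀ e b b′ x → actB e (B._∙_ e b b′) x ≡ actB e b′ (actB e b x)
  actB-∙ e (c , f) (d , g) x = sym (begin
    bPower e g (actA (αC e d) (bPower e f (actA (αC e c) x)))
      ≡⟨ cong (bPower e g) (bPower-twist e f d _) ⟩
    bPower e g (bPower e f (actA (αC e (twist^ e f d)) (actA (αC e c) x)))
      ≡⟨ bPower-xor e f g _ ⟩
    bPower e (f xor g) (actA (αC e (twist^ e f d)) (actA (αC e c) x))
      ≡⟨ cong (bPower e (f xor g)) (actA-∙ (αC e c) (αC e (twist^ e f d)) x) ⟨
    bPower e (f xor g) (actA (αC e (Cmul e c (twist^ e f d))) x) ∎)

  action : Action Point
  action = record
    { actA   = actA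
    ; actA-≈ = λ a≈a′ → actA-cong (≈⇒SameCoordinates a≈a′)
    ; actA-∙ = actA-∙
    ; actA-ε = actA-trivial ε-trivial
    ; actB   = actB
    ; actB-≈ = λ { e {c , f} (c≈c′ , refl) x →
                   cong (bPower e f) (actA-cong (≈⇒SameCoordinates c≈c′) x) }
    ; actB-∙ = actB-∙
    ; actB-ε = λ e → actA-trivial ε-trivial
    ; actC   = λ e c x → refl
    }

  open Action action public using (actWord; actWord-resp-∼)

  x₀ : Fin k → Point
  x₀ i = zero , just (ω i)

  stabiliser-x₀ : ∀ i a → actA a (x₀ i) ≡ x₀ i → component a zero ⟨$⟩ʳ ω i ≡ ω i
  stabiliser-x₀ i a fixed = just-injective (cong proj₂ fixed)

  -- b_i⁻¹ = (1⁻¹)^{b_i} b_i acts exactly as b_i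
  b⁻¹-acts-as-b : ∀ i x → actB i (B._⁻¹ i (b i)) x ≡ bAct i x
  b⁻¹-acts-as-b i x = cong (bAct i) (actA-trivial (twist-trivial i _ (ε⁻¹-trivial i)) x)

  -- b_i moves x₀ i to an extra point, which A fixes; so A^{b_i} fixes x₀ i
  conjugate-fixes-x₀ : ∀ i a →
    actWord (b⟨ i , B._⁻¹ i (b i) ⟩ ++ a⟨ a ⟩ ++ b⟨ i , b i ⟩) (x₀ i) ≡ x₀ i
  conjugate-fixes-x₀ i a = begin
    actB i (b i) (actA a (actB i (B._⁻¹ i (b i)) (x₀ i)))
      ≡⟨ cong (λ x → actB i (b i) (actA a x)) (b⁻¹-acts-as-b i (x₀ i)) ⟩
    actB i (b i) (actA a (bAct i (x₀ i)))
      ≡⟨ cong (λ x → actB i (b i) (actA a x)) x₀-to-extra ⟩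
    bAct i (blockPerm i zero , nothing)
      ≡⟨ cong (bAct i) x₀-to-extra ⟨
    bAct i (bAct i (x₀ i))
      ≡⟨ bAct-involutive i (x₀ i) ⟩
    x₀ i ∎
    where
    x₀-to-extra : bAct i (x₀ i) ≡ (blockPerm i zero , nothing)
    x₀-to-extra = cong (blockPerm i zero ,_) (swapWith-self _≟_ (ω i))

  A∩A^b⊆C : ∀ i w → InA w × InA^ i (b i) w → InC i w
  A∩A^b⊆C i w ((a@((g , g∈L) , xs) , w∼a) , (a′ , w∼a′^b)) =
    ((g , g∈L , stabiliser-x₀ i a a-fixes-x₀) , xs) , w∼a
    where
    a-fixes-x₀ : actA a (x₀ i) ≡ x₀ i
    a-fixes-x₀ = begin
      actWord a⟨ a ⟩ (x₀ i)  ≡⟨ actWord-resp-∼ w∼a (x₀ i) ⟨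
      actWord w (x₀ i)       ≡⟨ actWord-resp-∼ w∼a′^b (x₀ i) ⟩
      actWord (b⟨ i , B._⁻¹ i (b i) ⟩ ++ a⟨ a′ ⟩ ++ b⟨ i , b i ⟩) (x₀ i)
                             ≡⟨ conjugate-fixes-x₀ i a′ ⟩
      x₀ i                   ∎

  -- in B_i:  b_i⁻¹ · c^{b_i} · b_i = c.  Moving c^{b_i} into B_i, the word
  -- multiplies out to a single letter of B_i whose coordinates are those of c.
  conjugate-twist : ∀ i (c : Ccar i) →
    b⟨ i , B._⁻¹ i (b i) ⟩ ++ a⟨ αC i (twist i c) ⟩ ++ b⟨ i , b i ⟩ ∼ a⟨ αC i c ⟩
  conjugate-twist i c =
    ∼-trans (∼-++ {u = b⟨ i , b⁻¹ ⟩} ∼-refl (∼-++ {v = b⟨ i , b i ⟩} (amalg i (twist i c)) ∼-refl))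
    (∼-trans (∼-++ {v = b⟨ i , b i ⟩} (B-∙ i b⁻¹ (twist i c , false)) ∼-refl)
    (∼-trans (B-∙ i _ (b i))
    (∼-trans (B-≈ i (SameCoordinates⇒≈ product-is-c , refl))
    (∼-sym (amalg i c)))))
    where
    b⁻¹ : B.Carrier i
    b⁻¹ = B._⁻¹ i (b i)
    product-is-c : SameCoordinates
      (αC i (Cmul i (Cmul i (twist i (Cinv i (Cone i))) (twist i (twist i c))) (twist i (Cone i))))
      (αC i c)
    product-is-c j y =
      trans (trivial-∙ʳ (twist-trivial i (Cone i) ε-trivial) j y)
      (trans (trivial-∙ˡ (twist-trivial i _ (ε⁻¹-trivial i)) j y)
      (twist-involutive i c j y))

  -- c ∈ C_i lies in A, and in A^{b_i} as the conjugate of c^{b_i}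
  C⊆A∩A^b : ∀ i w → InC i w → InA w × InA^ i (b i) w
  C⊆A∩A^b i w (c , w∼c) =
    (αC i c , w∼c) , (αC i (twist i c) , ∼-trans w∼c (∼-sym (conjugate-twist i c)))

lemma2p3 : {m : ℕ} (L : PermGroup m) (n : ℕ) {k′ : ℕ} (ω : Fin (suc (suc k′)) → Fin m) →
    ¬ IsTransitive L → ¬ IsSemiregular L → IsOrbitReps L ω → StabNontrivial L (ω zero) → 2 ≤ n →
    (i : Fin (suc (suc k′))) (w : Construction.Word L n ω) →
    (Construction.InA L n ω w × Construction.InA^ L n ω i (Construction.b L n ω i) w)
    ⇔ Construction.InC L n ω i w
lemma2p3 L n ω _ _ _ _ _ i w = mk⇔ (A∩A^b⊆C i w) (C⊆A∩A^b i w)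
  where open PointAction L n ω
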